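{- Let $S$ be a monoid whose regular core $R$ is a rectangular band of groups. Then for every $a\in R$ and every idempotent $e\in R$, there exists a polygon isomorphism $f:Sa\to Se$ with $f(a)=e$ if and only if $ea=a$.
   Context: For a monoid $S$, a (left) $S$-polygon is a set $A$ with an action $S\times A\to A$ satisfying $s_1(s_2a)=(s_1s_2)a$ and $1a=a$; $Sa=\{sa\mid s\in S\}$, and $S$ acts on itself by left multiplication. An element $a$ of a polygon is act-regular if there is a polygon homomorphism $\varphi:Sa\to S$ with $\varphi(a)a=a$; a polygon is regular if all its elements are act-regular. The regular core $R$ of $S$ is the set of $a\in S$ such that $Sa$ is a regular polygon (assumed nonempty); it is a subsemigroup of $S$. A semigroup $T$ is a rectangular band of groups if $T=\bigcup\{T_{ij}\mid i\in I,\ j\in J\}$ is a partition of $T$ into subgroups $T_{ij}$ with $T_{ij}T_{kl}\subseteq T_{il}$ for all $i,k\in I$, $j,l\in J$. -}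

module Defs where

open import Level using (Level; _⊔_; suc)
open import Algebra.Bundles using (Monoid)
open import Data.Product using (Σ; ∃; ∃-syntax; _×_; _,_; proj₁; proj₂)
open import Relation.Binary.PropositionalEquality using (_≡_)

module _ {c ℓ : Level} (M : Monoid c ℓ) where
  open Monoid M renaming (Carrier to S)

  InS : S → S → Set (c ⊔ ℓ)
  InS a x = ∃[ s ] (x ≈ s ∙ a)

  -- the carrier of the polygon S a (equality: equality of underlying elements)
  Sa : S → Set (c ⊔ ℓ)
  Sa a = Σ S (InS a)

  gen : (a : S) → Sa a
  gen a = a , (ε , sym (identityˡ a))

  act : {a : S} → S → Sa a → Sa a
  act {a} s (x , (t , x≈ta)) =
    s ∙ x , (s ∙ t , trans (∙-congˡ x≈ta) (sym (assoc s t a)))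

  record HomToS (a : S) : Set (c ⊔ ℓ) where
    field
      fun   : Sa a → S
      cong  : ∀ u v → proj₁ u ≈ proj₁ v → fun u ≈ fun v
      equiv : ∀ s u → fun (act s u) ≈ s ∙ fun u

  -- a is act-regular (as an element of the polygon S, equivalently of any
  -- subpolygon S b containing it, since the cyclic subpolygon S a is the same)
  ActRegular : S → Set (c ⊔ ℓ)
  ActRegular a = ∃[ φ ] (HomToS.fun φ (gen a) ∙ a ≈ a)

  RegularPolygon : S → Set (c ⊔ ℓ)
  RegularPolygon b = ∀ x → InS b x → ActRegular x

  InCore : S → Set (c ⊔ ℓ)
  InCore = RegularPolygon

  record Hom (a b : S) : Set (c ⊔ ℓ) where
    field
      fun   : Sa a → Sa b
      cong  : ∀ u v → proj₁ u ≈ proj₁ v → proj₁ (fun u) ≈ proj₁ (fun v)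
      equiv : ∀ s u → proj₁ (fun (act s u)) ≈ proj₁ (act s (fun u))

  record Iso (a b : S) : Set (c ⊔ ℓ) where
    field
      to    : Hom a b
      from  : Hom b a
      from∘to : ∀ u → proj₁ (Hom.fun from (Hom.fun to u)) ≈ proj₁ u
      to∘from : ∀ v → proj₁ (Hom.fun to (Hom.fun from v)) ≈ proj₁ v

  Idempotent : S → Set ℓ
  Idempotent e = e ∙ e ≈ e

  record IsSubgroup (T : S → Set (c ⊔ ℓ)) : Set (c ⊔ ℓ) where
    field
      resp  : ∀ {x y} → x ≈ y → T x → T y
      one   : S
      one∈  : T one
      idˡ   : ∀ x → T x → one ∙ x ≈ x
      idʳ   : ∀ x → T x → x ∙ one ≈ x
      closed : ∀ x y → T x → T y → T (x ∙ y)
      inv   : ∀ x → T x → ∃[ y ] (T y × (x ∙ y ≈ one) × (y ∙ x ≈ one))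

  record RectangularBandOfGroups (R : S → Set (c ⊔ ℓ)) : Set (suc (c ⊔ ℓ)) where
    field
      I J       : Set (c ⊔ ℓ)
      T         : I → J → S → Set (c ⊔ ℓ)
      subgroup  : ∀ i j → IsSubgroup (T i j)
      T⊆R       : ∀ i j x → T i j x → R x
      cover     : ∀ x → R x → Σ I λ i → Σ J λ j → T i j x
      disjoint  : ∀ i j k l x → T i j x → T k l x → (i ≡ k) × (j ≡ l)
      rect      : ∀ i j k l x y → T i j x → T k l y → T i l (x ∙ y)

-- If f : S a ≅ S e sends a to e, then a = f⁻¹(e) = f⁻¹(e e) = e f⁻¹(e) = e a.
-- Conversely, whenever a and e generate the same principal right ideal, s a ↦ s e
-- is a well-defined isomorphism S a ≅ S e.  Here e a = a gives a ∈ e S, and in a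
-- rectangular band of groups e a = a forces a and e into the same row T i _, where
-- e is the identity of its group T i l; inverting a e ∈ T i l then gives e ∈ a S.
module Submission where

open import Defs
open import Level using (Level; _⊔_)
open import Algebra.Bundles using (Monoid)
open import Data.Product using (Σ; ∃-syntax; _,_; proj₁)
open import Function.Bundles using (_⇔_; mk⇔)
open import Relation.Binary.PropositionalEquality as ≡ using (_≡_)
import Relation.Binary.Reasoning.Setoid as SetoidReasoning

module _ {c ℓ : Level} (M : Monoid c ℓ) where
  open Monoid M renaming (Carrier to S)
  open SetoidReasoning setoid

  _≤ᴿ_ : S → S → Set (c ⊔ ℓ)
  x ≤ᴿ y = ∃[ z ] (x ≈ y ∙ z)

  equalised-≤ᴿ : ∀ {x y} → x ≤ᴿ y → ∀ s t → s ∙ y ≈ t ∙ y → s ∙ x ≈ t ∙ x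
  equalised-≤ᴿ {x} {y} (z , x≈yz) s t sy≈ty = begin
    s ∙ x       ≈⟨ ∙-congˡ x≈yz ⟩
    s ∙ (y ∙ z) ≈⟨ assoc s y z ⟨
    (s ∙ y) ∙ z ≈⟨ ∙-congʳ sy≈ty ⟩
    (t ∙ y) ∙ z ≈⟨ assoc t y z ⟩
    t ∙ (y ∙ z) ≈⟨ ∙-congˡ x≈yz ⟨
    t ∙ x       ∎

  ≤ᴿ⇒Hom : ∀ {x y} → y ≤ᴿ x → Hom M x y
  ≤ᴿ⇒Hom {x} {y} y≤x = record
    { fun   = λ { (_ , (s , _)) → s ∙ y , (s , refl) }
    ; cong  = λ { (_ , (s , u≈sx)) (_ , (t , v≈tx)) u≈v →
                  equalised-≤ᴿ y≤x s t (trans (sym u≈sx) (trans u≈v v≈tx)) }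
    ; equiv = λ { r (_ , (s , _)) → assoc r s y }
    }

  ≤ᴿ-antisym⇒Iso : ∀ {a e} → a ≤ᴿ e → e ≤ᴿ a →
                   Σ (Iso M a e) λ f → proj₁ (Hom.fun (Iso.to f) (gen M a)) ≈ e
  ≤ᴿ-antisym⇒Iso a≤e e≤a = iso , identityˡ _
    where
      iso : Iso M _ _
      iso = record
        { to      = ≤ᴿ⇒Hom e≤a
        ; from    = ≤ᴿ⇒Hom a≤e
        ; from∘to = λ { (_ , (_ , u≈sa)) → sym u≈sa }
        ; to∘from = λ { (_ , (_ , v≈te)) → sym v≈te }
        }

  Hom-idempotent-gen : ∀ {e x} → Idempotent M e → (g : Hom M e x) →
                       e ∙ proj₁ (Hom.fun g (gen M e)) ≈ proj₁ (Hom.fun g (gen M e))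
  Hom-idempotent-gen {e} ee g = begin
    e ∙ proj₁ (Hom.fun g (gen M e))       ≈⟨ Hom.equiv g e (gen M e) ⟨
    proj₁ (Hom.fun g (act M e (gen M e))) ≈⟨ Hom.cong g (act M e (gen M e)) (gen M e) ee ⟩
    proj₁ (Hom.fun g (gen M e))           ∎

  Iso-gen⇒absorbs : ∀ {a e} → Idempotent M e →
                    (Σ (Iso M a e) λ f → proj₁ (Hom.fun (Iso.to f) (gen M a)) ≈ e) →
                    e ∙ a ≈ a
  Iso-gen⇒absorbs {a} {e} ee (f , f[a]≈e) = begin
    e ∙ a    ≈⟨ ∙-congˡ g[e]≈a ⟨
    e ∙ g[e] ≈⟨ Hom-idempotent-gen ee (Iso.from f) ⟩
    g[e]     ≈⟨ g[e]≈a ⟩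
    a        ∎
    where
      g[e] : S
      g[e] = proj₁ (Hom.fun (Iso.from f) (gen M e))
      g[e]≈a : g[e] ≈ a
      g[e]≈a = trans (Hom.cong (Iso.from f) (gen M e) (Hom.fun (Iso.to f) (gen M a)) (sym f[a]≈e))
                     (Iso.from∘to f (gen M a))

  idempotent⇒one : ∀ {H} (G : IsSubgroup M H) → ∀ {x} → H x → Idempotent M x →
                   x ≈ IsSubgroup.one G
  idempotent⇒one G {x} Hx xx with IsSubgroup.inv G x Hx
  ... | y , _ , xy≈1 , _ = begin
    x           ≈⟨ IsSubgroup.idʳ G x Hx ⟨
    x ∙ one     ≈⟨ ∙-congˡ xy≈1 ⟨
    x ∙ (x ∙ y) ≈⟨ assoc x x y ⟨
    (x ∙ x) ∙ y ≈⟨ ∙-congʳ xx ⟩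
    x ∙ y       ≈⟨ xy≈1 ⟩
    one         ∎
    where open IsSubgroup G using (one)

  module _ {R : S → Set (c ⊔ ℓ)} (RB : RectangularBandOfGroups M R) where
    open RectangularBandOfGroups RB

    absorbs⇒sameRow : ∀ {i j k l a e} → T i j a → T k l e → e ∙ a ≈ a → k ≡ i
    absorbs⇒sameRow {i} {j} {k} {l} Ta Te ea≈a =
      proj₁ (disjoint k j i j _ (IsSubgroup.resp (subgroup k j) ea≈a (rect k l i j _ _ Te Ta)) Ta)

    sameRow⇒≤ᴿ : ∀ {i j l a e} → T i j a → T i l e → Idempotent M e → e ≤ᴿ a
    sameRow⇒≤ᴿ {i} {j} {l} {a} {e} Ta Te ee
      with IsSubgroup.inv (subgroup i l) (a ∙ e) (rect i j i l a e Ta Te)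
    ... | w , _ , aew≈1 , _ = e ∙ w , (begin
      e                ≈⟨ idempotent⇒one G Te ee ⟩
      IsSubgroup.one G ≈⟨ aew≈1 ⟨
      (a ∙ e) ∙ w      ≈⟨ assoc a e w ⟩
      a ∙ (e ∙ w)      ∎)
      where G = subgroup i l

    absorbs⇒≤ᴿ : ∀ {a e} → R a → R e → Idempotent M e → e ∙ a ≈ a → e ≤ᴿ a
    absorbs⇒≤ᴿ Ra Re ee ea≈a with cover _ Ra | cover _ Re
    ... | i , j , Ta | k , l , Te with absorbs⇒sameRow Ta Te ea≈a
    ... | ≡.refl = sameRow⇒≤ᴿ Ta Te ee

lemma6p8 : {c ℓ : Level} (M : Monoid c ℓ) →
    (∃[ r ] InCore M r) →
    RectangularBandOfGroups M (InCore M) →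
    ∀ (a : Monoid.Carrier M) → InCore M a →
    ∀ (e : Monoid.Carrier M) → InCore M e → Idempotent M e →
    (Σ (Iso M a e) λ f →
        Monoid._≈_ M (proj₁ (Hom.fun (Iso.to f) (gen M a))) e)
      ⇔ (Monoid._≈_ M (Monoid._∙_ M e a) a)
lemma6p8 M _ RB a Ra e Re ee =
  mk⇔ (Iso-gen⇒absorbs M ee)
      (λ ea≈a → ≤ᴿ-antisym⇒Iso M (a , Monoid.sym M ea≈a) (absorbs⇒≤ᴿ M RB Ra Re ee ea≈a))
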